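{- The clause set $S_\triangleright(\eta)$ is refutable by a clause set cycle, and $I\mathrm{Open}(L'_\triangleright)\nvdash\neg S_\triangleright(\eta)$.
   Context: $L'_\triangleright$ is the one-sorted first-order language (its single sort playing the role of $\mathsf{nat}$) with function symbols $0$ (constant), $s$ (unary), $+$ (binary, infix) and a binary predicate symbol $\triangleright$ (infix); $\eta$ is a distinguished variable. $S_\triangleright(\eta)$ is the clause set (conjunction) consisting of: $\forall x\,x+0=x$; $\forall x\forall y\,x+sy=s(x+y)$; $0\triangleright0$; $\forall x\forall y\,(x\triangleright y\to sx\triangleright(sx+y))$; $\forall y\,\neg\,\eta\triangleright y$. For $k\in\mathbb{N}$, $\overline{k}=s^k0$. A clause is a formula $\forall\vec y\,(l_1\vee\dots\vee l_k)$ with literals $l_i$, a clause set a finite conjunction of clauses. $\varphi\models\psi$ means every structure and variable assignment satisfying $\varphi$ satisfies $\psi$. A clause set $S(\eta)$ is a clause set cycle if $S(s\eta)\models S(\eta)$ and $S(0)\models\bot$. A clause set $R(\eta)$ is refutable by a clause set cycle if there is a clause set cycle $S(\eta)$ and $n\in\mathbb{N}$ with $R(s^n\eta)\models S(\eta)$ and $R(\overline{k})\models\bot$ for all $k\in\{0,\dots,n-1\}$. For a formula $\psi(x,\vec z)$, $I_x\psi:=\forall\vec z\,(\psi(0,\vec z)\to\forall x(\psi(x,\vec z)\to\psi(sx,\vec z))\to\forall x\,\psi(x,\vec z))$, and $I\mathrm{Open}(L'_\triangleright)$ is the set of all $I_x\psi$ with $\psi$ a quantifier-free $L'_\triangleright$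 formula. $\nvdash\neg S_\triangleright(\eta)$ means the universal closure of $\neg S_\triangleright(\eta)$ is not derivable. -}

module Defs where

open import Data.Nat using (ℕ; zero; suc; _<_)
open import Data.List using (List; []; _∷_)
open import Data.Product using (Σ; _×_; _,_)
open import Data.Sum using (_⊎_)
open import Data.Empty using (⊥)
open import Data.Unit using (⊤)
open import Relation.Binary.PropositionalEquality using (_≡_)
open import Relation.Nullary using (¬_)

-- Syntax of L'_▷ (one sort, with equality).  Variables are de Bruijn
-- indices; a free variable 0 in a formula S plays the role of η.

infixl 8 _⊕_
data Term : Set where
  v   : ℕ → Term
  𝟘   : Term
  𝕤   : Term → Term
  _⊕_ : Term → Term → Term

infix  6 _≐_ _▷_
infixr 5 _∧ᶠ_
infixr 4 _∨ᶠ_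
infixr 3 _⇒_
data Formula : Set where
  ⊥ᶠ   : Formula
  _≐_  : Term → Term → Formula
  _▷_  : Term → Term → Formula
  _⇒_  : Formula → Formula → Formula
  _∧ᶠ_ : Formula → Formula → Formula
  _∨ᶠ_ : Formula → Formula → Formula
  ∀ᶠ   : Formula → Formula
  ∃ᶠ   : Formula → Formula

infix 7 ¬ᶠ_
¬ᶠ_ : Formula → Formula
¬ᶠ φ = φ ⇒ ⊥ᶠ

⊤ᶠ : Formula
⊤ᶠ = ⊥ᶠ ⇒ ⊥ᶠ

∀ⁿ : ℕ → Formula → Formula
∀ⁿ zero    φ = φ
∀ⁿ (suc m) φ = ∀ᶠ (∀ⁿ m φ)

sⁿ : ℕ → Term → Term
sⁿ zero    t = t
sⁿ (suc n) t = 𝕤 (sⁿ n t)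

num : ℕ → Term
num k = sⁿ k 𝟘

ext : (ℕ → ℕ) → ℕ → ℕ
ext ρ zero    = zero
ext ρ (suc n) = suc (ρ n)

renT : (ℕ → ℕ) → Term → Term
renT ρ (v i)   = v (ρ i)
renT ρ 𝟘       = 𝟘
renT ρ (𝕤 t)   = 𝕤 (renT ρ t)
renT ρ (t ⊕ u) = renT ρ t ⊕ renT ρ u

renF : (ℕ → ℕ) → Formula → Formula
renF ρ ⊥ᶠ       = ⊥ᶠ
renF ρ (t ≐ u)  = renT ρ t ≐ renT ρ u
renF ρ (t ▷ u)  = renT ρ t ▷ renT ρ u
renF ρ (φ ⇒ ψ)  = renF ρ φ ⇒ renF ρ ψ
renF ρ (φ ∧ᶠ ψ) = renF ρ φ ∧ᶠ renF ρ ψ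
renF ρ (φ ∨ᶠ ψ) = renF ρ φ ∨ᶠ renF ρ ψ
renF ρ (∀ᶠ φ)   = ∀ᶠ (renF (ext ρ) φ)
renF ρ (∃ᶠ φ)   = ∃ᶠ (renF (ext ρ) φ)

shiftF : Formula → Formula
shiftF = renF suc

exts : (ℕ → Term) → ℕ → Term
exts σ zero    = v zero
exts σ (suc n) = renT suc (σ n)

substT : (ℕ → Term) → Term → Term
substT σ (v i)   = σ i
substT σ 𝟘       = 𝟘
substT σ (𝕤 t)   = 𝕤 (substT σ t)
substT σ (t ⊕ u) = substT σ t ⊕ substT σ u

substF : (ℕ → Term) → Formula → Formula
substF σ ⊥ᶠ       = ⊥ᶠ
substF σ (t ≐ u)  = substT σ t ≐ substT σ u
substF σ (t ▷ u)  = substT σ t ▷ substT σ u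
substF σ (φ ⇒ ψ)  = substF σ φ ⇒ substF σ ψ
substF σ (φ ∧ᶠ ψ) = substF σ φ ∧ᶠ substF σ ψ
substF σ (φ ∨ᶠ ψ) = substF σ φ ∨ᶠ substF σ ψ
substF σ (∀ᶠ φ)   = ∀ᶠ (substF (exts σ) φ)
substF σ (∃ᶠ φ)   = ∃ᶠ (substF (exts σ) φ)

single : Term → ℕ → Term
single t zero    = t
single t (suc n) = v n

_[_] : Formula → Term → Formula
φ [ t ] = substF (single t) φ

-- φ ⟨ t ⟩ : replace variable 0 by t, leaving all other variables
-- unchanged (this is φ(η) ↦ φ(t) for the distinguished variable η = 0).
at0 : Term → ℕ → Term
at0 t zero    = t
at0 t (suc n) = v (suc n)

_⟨_⟩ : Formula → Term → Formula
φ ⟨ t ⟩ = substF (at0 t) φ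

infix 6 _≐ₐ_ _▷ₐ_
data Atom : Set where
  _≐ₐ_ : Term → Term → Atom
  _▷ₐ_ : Term → Term → Atom

data Literal : Set where
  pos : Atom → Literal
  neg : Atom → Literal

-- a clause ∀ y₁ … yₘ (l₁ ∨ … ∨ lₖ); inside, y's are indices 0…m-1
-- and the free variables (η) are shifted by m
record Clause : Set where
  constructor clause
  field
    nvars : ℕ
    lits  : List Literal

ClauseSet : Set
ClauseSet = List Clause

atomF : Atom → Formula
atomF (t ≐ₐ u) = t ≐ u
atomF (t ▷ₐ u) = t ▷ u

litF : Literal → Formula
litF (pos a) = atomF a
litF (neg a) = ¬ᶠ atomF a

disj : List Literal → Formula
disj []       = ⊥ᶠ
disj (l ∷ ls) = litF l ∨ᶠ disj ls

clauseF : Clause → Formula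
clauseF (clause m ls) = ∀ⁿ m (disj ls)

⟦_⟧ : ClauseSet → Formula
⟦ [] ⟧     = ⊤ᶠ
⟦ c ∷ cs ⟧ = clauseF c ∧ᶠ ⟦ cs ⟧

record Structure : Set₁ where
  field
    D   : Set
    z   : D
    s   : D → D
    add : D → D → D
    tri : D → D → Set

module _ (M : Structure) where
  open Structure M

  _∷ₑ_ : D → (ℕ → D) → ℕ → D
  (d ∷ₑ ρ) zero    = d
  (d ∷ₑ ρ) (suc n) = ρ n

  evalT : (ℕ → D) → Term → D
  evalT ρ (v i)   = ρ i
  evalT ρ 𝟘       = z
  evalT ρ (𝕤 t)   = s (evalT ρ t)
  evalT ρ (t ⊕ u) = add (evalT ρ t) (evalT ρ u)

  Sat : (ℕ → D) → Formula → Set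
  Sat ρ ⊥ᶠ       = ⊥
  Sat ρ (t ≐ u)  = evalT ρ t ≡ evalT ρ u
  Sat ρ (t ▷ u)  = tri (evalT ρ t) (evalT ρ u)
  Sat ρ (φ ⇒ ψ)  = Sat ρ φ → Sat ρ ψ
  Sat ρ (φ ∧ᶠ ψ) = Sat ρ φ × Sat ρ ψ
  Sat ρ (φ ∨ᶠ ψ) = Sat ρ φ ⊎ Sat ρ ψ
  Sat ρ (∀ᶠ φ)   = (d : D) → Sat (d ∷ₑ ρ) φ
  Sat ρ (∃ᶠ φ)   = Σ D (λ d → Sat (d ∷ₑ ρ) φ)

infix 2 _⊨_
_⊨_ : Formula → Formula → Set₁
φ ⊨ ψ = (M : Structure) (ρ : ℕ → Structure.D M) → Sat M ρ φ → Sat M ρ ψ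

η : Term
η = v zero

IsClauseSetCycle : ClauseSet → Set₁
IsClauseSetCycle S = (⟦ S ⟧ ⟨ 𝕤 η ⟩ ⊨ ⟦ S ⟧) × (⟦ S ⟧ ⟨ 𝟘 ⟩ ⊨ ⊥ᶠ)

RefutableByCycle : ClauseSet → Set₁
RefutableByCycle R =
  Σ ClauseSet λ S → Σ ℕ λ n →
    IsClauseSetCycle S
    × (⟦ R ⟧ ⟨ sⁿ n η ⟩ ⊨ ⟦ S ⟧)
    × ((k : ℕ) → k < n → ⟦ R ⟧ ⟨ num k ⟩ ⊨ ⊥ᶠ)

S▷ : ClauseSet
S▷ =
    clause 1 (pos (v 0 ⊕ 𝟘 ≐ₐ v 0) ∷ [])
  ∷ clause 2 (pos (v 1 ⊕ 𝕤 (v 0) ≐ₐ 𝕤 (v 1 ⊕ v 0)) ∷ [])     -- ∀x∀y x+sy=s(x+y)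
  ∷ clause 0 (pos (𝟘 ▷ₐ 𝟘) ∷ [])
  ∷ clause 2 (neg (v 1 ▷ₐ v 0)
               ∷ pos (𝕤 (v 1) ▷ₐ (𝕤 (v 1) ⊕ v 0)) ∷ [])        -- ∀x∀y (x▷y → sx▷(sx+y))
  ∷ clause 1 (neg (v 1 ▷ₐ v 0) ∷ [])                           -- ∀y ¬ η▷y
  ∷ []

QF : Formula → Set
QF ⊥ᶠ       = ⊤
QF (t ≐ u)  = ⊤
QF (t ▷ u)  = ⊤
QF (φ ⇒ ψ)  = QF φ × QF ψ
QF (φ ∧ᶠ ψ) = QF φ × QF ψ
QF (φ ∨ᶠ ψ) = QF φ × QF ψ
QF (∀ᶠ φ)   = ⊥
QF (∃ᶠ φ)   = ⊥

VarsBelowT : ℕ → Term → Set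
VarsBelowT n (v i)   = i < n
VarsBelowT n 𝟘       = ⊤
VarsBelowT n (𝕤 t)   = VarsBelowT n t
VarsBelowT n (t ⊕ u) = VarsBelowT n t × VarsBelowT n u

VarsBelow : ℕ → Formula → Set
VarsBelow n ⊥ᶠ       = ⊤
VarsBelow n (t ≐ u)  = VarsBelowT n t × VarsBelowT n u
VarsBelow n (t ▷ u)  = VarsBelowT n t × VarsBelowT n u
VarsBelow n (φ ⇒ ψ)  = VarsBelow n φ × VarsBelow n ψ
VarsBelow n (φ ∧ᶠ ψ) = VarsBelow n φ × VarsBelow n ψ
VarsBelow n (φ ∨ᶠ ψ) = VarsBelow n φ × VarsBelow n ψ
VarsBelow n (∀ᶠ φ)   = VarsBelow (suc n) φ
VarsBelow n (∃ᶠ φ)   = VarsBelow (suc n) φ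

-- For ψ(x, z₁ … zₘ) with x = variable 0 and zᵢ = variable i:
-- I_x ψ = ∀z⃗ (ψ(0,z⃗) → ∀x(ψ(x,z⃗) → ψ(sx,z⃗)) → ∀x ψ(x,z⃗))
Ind : ℕ → Formula → Formula
Ind m ψ = ∀ⁿ m (ψ [ 𝟘 ] ⇒ (∀ᶠ (ψ ⇒ ψ ⟨ 𝕤 (v 0) ⟩) ⇒ ∀ᶠ ψ))

IOpen : Formula → Set
IOpen φ = Σ ℕ λ m → Σ Formula λ ψ → QF ψ × VarsBelow (suc m) ψ × φ ≡ Ind m ψ

Ctx : Set₁
Ctx = Formula → Set

infixl 2 _,,_
_,,_ : Ctx → Formula → Ctx
(Γ ,, φ) ψ = Γ ψ ⊎ ψ ≡ φ

shiftCtx : Ctx → Ctx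
shiftCtx Γ φ = Σ Formula λ ψ → Γ ψ × φ ≡ shiftF ψ

infix 1 _⊢_
data _⊢_ (Γ : Ctx) : Formula → Set₁ where
  hyp   : ∀ {φ} → Γ φ → Γ ⊢ φ
  raa   : ∀ {φ} → (Γ ,, ¬ᶠ φ) ⊢ ⊥ᶠ → Γ ⊢ φ
  ⇒I    : ∀ {φ ψ} → (Γ ,, φ) ⊢ ψ → Γ ⊢ φ ⇒ ψ
  ⇒E    : ∀ {φ ψ} → Γ ⊢ φ ⇒ ψ → Γ ⊢ φ → Γ ⊢ ψ
  ∧I    : ∀ {φ ψ} → Γ ⊢ φ → Γ ⊢ ψ → Γ ⊢ φ ∧ᶠ ψ
  ∧E₁   : ∀ {φ ψ} → Γ ⊢ φ ∧ᶠ ψ → Γ ⊢ φ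
  ∧E₂   : ∀ {φ ψ} → Γ ⊢ φ ∧ᶠ ψ → Γ ⊢ ψ
  ∨I₁   : ∀ {φ ψ} → Γ ⊢ φ → Γ ⊢ φ ∨ᶠ ψ
  ∨I₂   : ∀ {φ ψ} → Γ ⊢ ψ → Γ ⊢ φ ∨ᶠ ψ
  ∨E    : ∀ {φ ψ χ} → Γ ⊢ φ ∨ᶠ ψ → (Γ ,, φ) ⊢ χ → (Γ ,, ψ) ⊢ χ → Γ ⊢ χ
  ∀I    : ∀ {φ} → shiftCtx Γ ⊢ φ → Γ ⊢ ∀ᶠ φ
  ∀E    : ∀ {φ} (t : Term) → Γ ⊢ ∀ᶠ φ → Γ ⊢ φ [ t ]
  ∃I    : ∀ {φ} (t : Term) → Γ ⊢ φ [ t ] → Γ ⊢ ∃ᶠ φ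
  ∃E    : ∀ {φ χ} → Γ ⊢ ∃ᶠ φ → (shiftCtx Γ ,, φ) ⊢ shiftF χ → Γ ⊢ χ
  ≐refl : ∀ (t : Term) → Γ ⊢ t ≐ t
  ≐sub  : ∀ {φ t u} → Γ ⊢ t ≐ u → Γ ⊢ φ [ t ] → Γ ⊢ φ [ u ]

-- A clause set cycle for S▷ is S▷ itself: from S▷(sη), an η ▷ y would give sη ▷ (sη + y) by the
-- fourth clause, contradicting the last one at sη; and S▷(0) contradicts 0 ▷ 0.
--
-- For underivability, take the integers with x ▷ y iff x = n ≥ 0 and y is the n-th triangular
-- number, and η = −1. There S▷ holds, since ▷ only relates nonnegative x. Open induction is valid:
-- once a parameter is fixed, every term is an affine function c·d + p of the induction variable d
-- with c ∈ ℕ, so every atom is eventually constant as d → ±∞ (for ▷ with c > 0 it is eventually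
-- false, since a triangular number grows quadratically), and a quantifier-free formula therefore
-- has the same truth value at n and at −n−1 for all large n. Such a predicate, if closed under
-- successor and true at 0, holds on ℕ, hence far down in the negatives, hence everywhere. Since
-- ℤ is handled constructively, formulas are read with ∨ and ∃ double-negated, for which classical
-- natural deduction is sound because the atoms of this structure are decidable.
module Submission where

open import Defs
open import Data.Nat as ℕ using (ℕ; zero; suc; _≤_; z≤n; s≤s)
import Data.Nat.Properties as ℕP
open import Data.Product using (Σ; ∃-syntax; _×_; _,_; proj₁; proj₂)
open import Data.Product.Function.NonDependent.Propositional using (_×-⇔_)
open import Data.Sum using (_⊎_; inj₁; inj₂; fromInj₁)
open import Data.Sum.Function.Propositional using (_⊎-⇔_)
open import Data.Empty using (⊥; ⊥-elim)
open import Function using (_⇔_; mk⇔; Equivalence; _∘_; id)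
import Function.Properties.Equivalence as ⇔
open import Function.Related.TypeIsomorphisms using (→-cong-⇔; ¬-cong-⇔)
open import Relation.Binary.Definitions using (Decidable)
open import Relation.Binary.PropositionalEquality
  using (_≡_; _≢_; refl; sym; trans; cong; cong₂; subst; module ≡-Reasoning)
open import Relation.Binary.Structures using (IsEquivalence)
open import Relation.Nullary using (¬_; yes; no)
open import Relation.Nullary.Decidable using (decidable-stable)
open import Relation.Nullary.Negation using (Stable; negated-stable)

open Equivalence using (to; from)

implication : {A B : Set} → (¬ A) ⊎ (B ⊎ ⊥) → A → B
implication (inj₁ ¬a)       a = ⊥-elim (¬a a)
implication (inj₂ (inj₁ b)) _ = b

S▷-cycle : IsClauseSetCycle S▷
S▷-cycle = step , base
  where
  step : ⟦ S▷ ⟧ ⟨ 𝕤 η ⟩ ⊨ ⟦ S▷ ⟧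
  step M ρ (+0 , +s , 0▷0 , ▷-step , ¬sη▷ , _) =
    +0 , +s , 0▷0 , ▷-step ,
    (λ y → inj₁ λ η▷y → fromInj₁ ⊥-elim (¬sη▷ _) (implication (▷-step (ρ 0) y) η▷y)) , id

  base : ⟦ S▷ ⟧ ⟨ 𝟘 ⟩ ⊨ ⊥ᶠ
  base M ρ (_ , _ , 0▷0 , _ , ¬0▷ , _) =
    fromInj₁ ⊥-elim (¬0▷ (Structure.z M)) (fromInj₁ ⊥-elim 0▷0)

S▷-refutable : RefutableByCycle S▷
S▷-refutable = S▷ , 0 , S▷-cycle , (λ M ρ → id) , λ _ ()

≡⇒⇔ : {A B : Set} → A ≡ B → A ⇔ B
≡⇒⇔ = IsEquivalence.reflexive ⇔.⇔-isEquivalence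

Π-cong-⇔ : {D : Set} {A B : D → Set} → (∀ d → A d ⇔ B d) → ((d : D) → A d) ⇔ ((d : D) → B d)
Π-cong-⇔ A⇔B = mk⇔ (λ f d → to (A⇔B d) (f d)) (λ f d → from (A⇔B d) (f d))

module DoubleNegation (M : Structure) where
  open Structure M

  infixr 5 _∷_
  _∷_ : D → (ℕ → D) → ℕ → D
  _∷_ = _∷ₑ_ M

  ⟦_⟧ₜ : Term → (ℕ → D) → D
  ⟦ t ⟧ₜ ρ = evalT M ρ t

  Satᶜ : (ℕ → D) → Formula → Set
  Satᶜ ρ ⊥ᶠ       = ⊥
  Satᶜ ρ (t ≐ u)  = ⟦ t ⟧ₜ ρ ≡ ⟦ u ⟧ₜ ρ
  Satᶜ ρ (t ▷ u)  = tri (⟦ t ⟧ₜ ρ) (⟦ u ⟧ₜ ρ)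
  Satᶜ ρ (φ ⇒ ψ)  = Satᶜ ρ φ → Satᶜ ρ ψ
  Satᶜ ρ (φ ∧ᶠ ψ) = Satᶜ ρ φ × Satᶜ ρ ψ
  Satᶜ ρ (φ ∨ᶠ ψ) = ¬ ¬ (Satᶜ ρ φ ⊎ Satᶜ ρ ψ)
  Satᶜ ρ (∀ᶠ φ)   = (d : D) → Satᶜ (d ∷ ρ) φ
  Satᶜ ρ (∃ᶠ φ)   = ¬ ((d : D) → ¬ Satᶜ (d ∷ ρ) φ)

  evalT-renT : ∀ {ρ ρ′} f → (∀ i → ρ (f i) ≡ ρ′ i) → ∀ t → ⟦ renT f t ⟧ₜ ρ ≡ ⟦ t ⟧ₜ ρ′
  evalT-renT f ρ∘f≡ρ′ (v i)   = ρ∘f≡ρ′ i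
  evalT-renT f ρ∘f≡ρ′ 𝟘       = refl
  evalT-renT f ρ∘f≡ρ′ (𝕤 t)   = cong s (evalT-renT f ρ∘f≡ρ′ t)
  evalT-renT f ρ∘f≡ρ′ (t ⊕ u) = cong₂ add (evalT-renT f ρ∘f≡ρ′ t) (evalT-renT f ρ∘f≡ρ′ u)

  evalT-substT : ∀ {ρ ρ′} σ → (∀ i → ⟦ σ i ⟧ₜ ρ ≡ ρ′ i) → ∀ t → ⟦ substT σ t ⟧ₜ ρ ≡ ⟦ t ⟧ₜ ρ′
  evalT-substT σ ρσ≡ρ′ (v i)   = ρσ≡ρ′ i
  evalT-substT σ ρσ≡ρ′ 𝟘       = refl
  evalT-substT σ ρσ≡ρ′ (𝕤 t)   = cong s (evalT-substT σ ρσ≡ρ′ t)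
  evalT-substT σ ρσ≡ρ′ (t ⊕ u) = cong₂ add (evalT-substT σ ρσ≡ρ′ t) (evalT-substT σ ρσ≡ρ′ u)

  ext-∷ : ∀ {ρ ρ′} f → (∀ i → ρ (f i) ≡ ρ′ i) → ∀ d i → (d ∷ ρ) (ext f i) ≡ (d ∷ ρ′) i
  ext-∷ f h d zero    = refl
  ext-∷ f h d (suc i) = h i

  exts-∷ : ∀ {ρ ρ′} σ → (∀ i → ⟦ σ i ⟧ₜ ρ ≡ ρ′ i) → ∀ d i → ⟦ exts σ i ⟧ₜ (d ∷ ρ) ≡ (d ∷ ρ′) i
  exts-∷ σ h d zero    = refl
  exts-∷ σ h d (suc i) = trans (evalT-renT suc (λ _ → refl) (σ i)) (h i)

  Satᶜ-renF : ∀ {ρ ρ′} f → (∀ i → ρ (f i) ≡ ρ′ i) → ∀ φ → Satᶜ ρ (renF f φ) ⇔ Satᶜ ρ′ φ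
  Satᶜ-renF f h ⊥ᶠ       = ⇔.refl
  Satᶜ-renF f h (t ≐ u)  = ≡⇒⇔ (cong₂ _≡_ (evalT-renT f h t) (evalT-renT f h u))
  Satᶜ-renF f h (t ▷ u)  = ≡⇒⇔ (cong₂ tri (evalT-renT f h t) (evalT-renT f h u))
  Satᶜ-renF f h (φ ⇒ ψ)  = →-cong-⇔ (Satᶜ-renF f h φ) (Satᶜ-renF f h ψ)
  Satᶜ-renF f h (φ ∧ᶠ ψ) = Satᶜ-renF f h φ ×-⇔ Satᶜ-renF f h ψ
  Satᶜ-renF f h (φ ∨ᶠ ψ) = ¬-cong-⇔ (¬-cong-⇔ (Satᶜ-renF f h φ ⊎-⇔ Satᶜ-renF f h ψ))
  Satᶜ-renF f h (∀ᶠ φ)   = Π-cong-⇔ λ d → Satᶜ-renF (ext f) (ext-∷ f h d) φ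
  Satᶜ-renF f h (∃ᶠ φ)   = ¬-cong-⇔ (Π-cong-⇔ λ d → ¬-cong-⇔ (Satᶜ-renF (ext f) (ext-∷ f h d) φ))

  Satᶜ-substF : ∀ {ρ ρ′} σ → (∀ i → ⟦ σ i ⟧ₜ ρ ≡ ρ′ i) → ∀ φ → Satᶜ ρ (substF σ φ) ⇔ Satᶜ ρ′ φ
  Satᶜ-substF σ h ⊥ᶠ       = ⇔.refl
  Satᶜ-substF σ h (t ≐ u)  = ≡⇒⇔ (cong₂ _≡_ (evalT-substT σ h t) (evalT-substT σ h u))
  Satᶜ-substF σ h (t ▷ u)  = ≡⇒⇔ (cong₂ tri (evalT-substT σ h t) (evalT-substT σ h u))
  Satᶜ-substF σ h (φ ⇒ ψ)  = →-cong-⇔ (Satᶜ-substF σ h φ) (Satᶜ-substF σ h ψ)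
  Satᶜ-substF σ h (φ ∧ᶠ ψ) = Satᶜ-substF σ h φ ×-⇔ Satᶜ-substF σ h ψ
  Satᶜ-substF σ h (φ ∨ᶠ ψ) = ¬-cong-⇔ (¬-cong-⇔ (Satᶜ-substF σ h φ ⊎-⇔ Satᶜ-substF σ h ψ))
  Satᶜ-substF σ h (∀ᶠ φ)   = Π-cong-⇔ λ d → Satᶜ-substF (exts σ) (exts-∷ σ h d) φ
  Satᶜ-substF σ h (∃ᶠ φ)   = ¬-cong-⇔ (Π-cong-⇔ λ d → ¬-cong-⇔ (Satᶜ-substF (exts σ) (exts-∷ σ h d) φ))

  Satᶜ-shiftF : ∀ {ρ} d φ → Satᶜ (d ∷ ρ) (shiftF φ) ⇔ Satᶜ ρ φ
  Satᶜ-shiftF d = Satᶜ-renF suc (λ _ → refl)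

  Satᶜ-[] : ∀ {ρ} φ t → Satᶜ ρ (φ [ t ]) ⇔ Satᶜ (⟦ t ⟧ₜ ρ ∷ ρ) φ
  Satᶜ-[] φ t = Satᶜ-substF (single t) (λ { zero → refl ; (suc i) → refl }) φ

  Satᶜ-⟨⟩ : ∀ {d ρ} φ t → Satᶜ (d ∷ ρ) (φ ⟨ t ⟩) ⇔ Satᶜ (⟦ t ⟧ₜ (d ∷ ρ) ∷ ρ) φ
  Satᶜ-⟨⟩ φ t = Satᶜ-substF (at0 t) (λ { zero → refl ; (suc i) → refl }) φ

  Satᶜ-∀ⁿ : ∀ m φ → (∀ ρ → Satᶜ ρ φ) → ∀ ρ → Satᶜ ρ (∀ⁿ m φ)
  Satᶜ-∀ⁿ zero    φ valid ρ   = valid ρ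
  Satᶜ-∀ⁿ (suc m) φ valid ρ d = Satᶜ-∀ⁿ m φ valid (d ∷ ρ)

  record _⊨ᶜ_ (ρ : ℕ → D) (Γ : Ctx) : Set where
    constructor satisfies
    field satᶜ : ∀ {ψ} → Γ ψ → Satᶜ ρ ψ
  open _⊨ᶜ_

  ⊨ᶜ-,, : ∀ {ρ Γ φ} → ρ ⊨ᶜ Γ → Satᶜ ρ φ → ρ ⊨ᶜ (Γ ,, φ)
  ⊨ᶜ-,, ρ⊨Γ ρ⊨φ = satisfies λ { (inj₁ Γψ) → satᶜ ρ⊨Γ Γψ ; (inj₂ refl) → ρ⊨φ }

  ⊨ᶜ-shiftCtx : ∀ {ρ Γ} d → ρ ⊨ᶜ Γ → (d ∷ ρ) ⊨ᶜ shiftCtx Γ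
  ⊨ᶜ-shiftCtx d ρ⊨Γ = satisfies λ { (ψ , Γψ , refl) → from (Satᶜ-shiftF d ψ) (satᶜ ρ⊨Γ Γψ) }

  module Soundness (≡-stable : (a b : D) → Stable (a ≡ b))
                   (tri-stable : (a b : D) → Stable (tri a b)) where

    Satᶜ-stable : ∀ ρ φ → Stable (Satᶜ ρ φ)
    Satᶜ-stable ρ ⊥ᶠ       ¬¬⊥ = ¬¬⊥ λ ()
    Satᶜ-stable ρ (t ≐ u)  = ≡-stable _ _
    Satᶜ-stable ρ (t ▷ u)  = tri-stable _ _
    Satᶜ-stable ρ (φ ⇒ ψ)  ¬¬f a = Satᶜ-stable ρ ψ λ ¬b → ¬¬f λ f → ¬b (f a)
    Satᶜ-stable ρ (φ ∧ᶠ ψ) ¬¬p =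
      Satᶜ-stable ρ φ (λ ¬a → ¬¬p (¬a ∘ proj₁)) , Satᶜ-stable ρ ψ (λ ¬b → ¬¬p (¬b ∘ proj₂))
    Satᶜ-stable ρ (φ ∨ᶠ ψ) = negated-stable
    Satᶜ-stable ρ (∀ᶠ φ)   ¬¬f d = Satᶜ-stable (d ∷ ρ) φ λ ¬a → ¬¬f λ f → ¬a (f d)
    Satᶜ-stable ρ (∃ᶠ φ)   = negated-stable

    sound : ∀ {Γ φ} → Γ ⊢ φ → ∀ ρ → ρ ⊨ᶜ Γ → Satᶜ ρ φ
    sound (hyp Γφ)    ρ ρ⊨Γ = satᶜ ρ⊨Γ Γφ
    sound {φ = φ} (raa ⊢⊥) ρ ρ⊨Γ = Satᶜ-stable ρ φ λ ¬φ → sound ⊢⊥ ρ (⊨ᶜ-,, ρ⊨Γ ¬φ)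
    sound (⇒I ⊢ψ)     ρ ρ⊨Γ a = sound ⊢ψ ρ (⊨ᶜ-,, ρ⊨Γ a)
    sound (⇒E ⊢f ⊢a)  ρ ρ⊨Γ = sound ⊢f ρ ρ⊨Γ (sound ⊢a ρ ρ⊨Γ)
    sound (∧I ⊢a ⊢b)  ρ ρ⊨Γ = sound ⊢a ρ ρ⊨Γ , sound ⊢b ρ ρ⊨Γ
    sound (∧E₁ ⊢p)    ρ ρ⊨Γ = proj₁ (sound ⊢p ρ ρ⊨Γ)
    sound (∧E₂ ⊢p)    ρ ρ⊨Γ = proj₂ (sound ⊢p ρ ρ⊨Γ)
    sound (∨I₁ ⊢a)    ρ ρ⊨Γ ¬a⊎b = ¬a⊎b (inj₁ (sound ⊢a ρ ρ⊨Γ))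
    sound (∨I₂ ⊢b)    ρ ρ⊨Γ ¬a⊎b = ¬a⊎b (inj₂ (sound ⊢b ρ ρ⊨Γ))
    sound {φ = χ} (∨E ⊢a∨b ⊢χ₁ ⊢χ₂) ρ ρ⊨Γ = Satᶜ-stable ρ χ λ ¬χ → sound ⊢a∨b ρ ρ⊨Γ λ
      { (inj₁ a) → ¬χ (sound ⊢χ₁ ρ (⊨ᶜ-,, ρ⊨Γ a))
      ; (inj₂ b) → ¬χ (sound ⊢χ₂ ρ (⊨ᶜ-,, ρ⊨Γ b)) }
    sound (∀I ⊢φ)     ρ ρ⊨Γ d = sound ⊢φ (d ∷ ρ) (⊨ᶜ-shiftCtx d ρ⊨Γ)
    sound (∀E {φ} t ⊢∀) ρ ρ⊨Γ = from (Satᶜ-[] φ t) (sound ⊢∀ ρ ρ⊨Γ (⟦ t ⟧ₜ ρ))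
    sound (∃I {φ} t ⊢φt) ρ ρ⊨Γ none = none (⟦ t ⟧ₜ ρ) (to (Satᶜ-[] φ t) (sound ⊢φt ρ ρ⊨Γ))
    sound (∃E {φ} {χ} ⊢∃ ⊢χ) ρ ρ⊨Γ = Satᶜ-stable ρ χ λ ¬χ → sound ⊢∃ ρ ρ⊨Γ λ d φd →
      ¬χ (to (Satᶜ-shiftF d χ) (sound ⊢χ (d ∷ ρ) (⊨ᶜ-,, (⊨ᶜ-shiftCtx d ρ⊨Γ) φd)))
    sound (≐refl t)   ρ ρ⊨Γ = refl
    sound (≐sub {φ} {t} {u} ⊢t≐u ⊢φt) ρ ρ⊨Γ = from (Satᶜ-[] φ u)
      (subst (λ a → Satᶜ (a ∷ ρ) φ) (sound ⊢t≐u ρ ρ⊨Γ) (to (Satᶜ-[] φ t) (sound ⊢φt ρ ρ⊨Γ)))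

module TriangularNumbers where
  open import Data.Nat
  open import Data.Nat.Properties
  open import Data.Nat.Tactic.RingSolver
  open import Relation.Binary.PropositionalEquality

  triangular : ℕ → ℕ
  triangular zero    = 0
  triangular (suc n) = suc n + triangular n

  2*triangular : ∀ m → 2 * triangular m ≡ m * suc m
  2*triangular zero    = refl
  2*triangular (suc m) = begin
    2 * (suc m + triangular m)     ≡⟨ *-distribˡ-+ 2 (suc m) (triangular m) ⟩
    2 * suc m + 2 * triangular m   ≡⟨ cong (2 * suc m +_) (2*triangular m) ⟩
    2 * suc m + m * suc m          ≡⟨ factor m ⟩
    suc m * suc (suc m)            ∎
    where
    open ≡-Reasoning
    factor : ∀ m → 2 * suc m + m * suc m ≡ suc m * suc (suc m)
    factor = solve-∀

  triangular-beats-affine : ∀ C E m → 2 * suc (C + E) ≤ m → C * m + E < triangular m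
  triangular-beats-affine C E m@(suc _) 2K≤m = *-cancelˡ-< 2 _ _ (begin-strict
    2 * (C * m + E)              <⟨ *-monoʳ-< 2 affine<mK ⟩
    2 * (m * K)                  ≡⟨ reorder m K ⟩
    m * (2 * K)                  ≤⟨ *-monoʳ-≤ m 2K≤m ⟩
    m * m                        ≤⟨ *-monoʳ-≤ m (n≤1+n m) ⟩
    m * suc m                    ≡⟨ 2*triangular m ⟨
    2 * triangular m             ∎)
    where
    open ≤-Reasoning
    K = suc (C + E)
    reorder : ∀ m K → 2 * (m * K) ≡ m * (2 * K)
    reorder = solve-∀
    expand : ∀ m C E → m * suc (C + E) ≡ m + (C * m + m * E)
    expand = solve-∀
    1≤m : 1 ≤ m
    1≤m = s≤s z≤n
    affine<mK : C * m + E < m * K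
    affine<mK = begin-strict
      C * m + E                  <⟨ s≤s (+-monoʳ-≤ (C * m) (m≤n*m E m)) ⟩
      1 + (C * m + m * E)        ≤⟨ +-monoˡ-≤ (C * m + m * E) 1≤m ⟩
      m + (C * m + m * E)        ≡⟨ expand m C E ⟨
      m * K                      ∎

  affine-threshold : ℕ → ℕ → ℕ → ℕ
  affine-threshold C P Q = P + 2 * suc (C + (C * P + Q))

  triangular≰affine : ∀ {n m C P Q} → affine-threshold C P Q ≤ n → n ≤ m + P →
                      triangular m ≰ C * n + Q
  triangular≰affine {n} {m} {C} {P} {Q} large n≤m+P Tm≤ = <-irrefl refl (begin-strict
    C * m + E                    <⟨ triangular-beats-affine C E m 2K≤m ⟩
    triangular m                 ≤⟨ Tm≤ ⟩
    C * n + Q                    ≤⟨ +-monoˡ-≤ Q (*-monoʳ-≤ C n≤m+P) ⟩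
    C * (m + P) + Q              ≡⟨ regroup C m P Q ⟩
    C * m + E                    ∎)
    where
    open ≤-Reasoning
    E = C * P + Q
    regroup : ∀ C m P Q → C * (m + P) + Q ≡ C * m + (C * P + Q)
    regroup = solve-∀
    2K≤m : 2 * suc (C + E) ≤ m
    2K≤m = +-cancelˡ-≤ P _ _ (≤-trans large (≤-trans n≤m+P (≤-reflexive (+-comm m P))))

open TriangularNumbers

module IntegerModel where
  open import Data.Integer as ℤ using (ℤ; +_; -[1+_]; ∣_∣; 0ℤ; 1ℤ; -1ℤ; _+_; _*_; _-_; -_)
  import Data.Integer.Properties as ℤP
  open import Data.Integer.Tactic.RingSolver using (solve-∀)
  open import Algebra.Properties.AbelianGroup ℤP.+-0-abelianGroup using (∙-cancelˡ)

  record EventuallySymmetric (P : ℤ → Set) : Set where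
    constructor symmetric-beyond
    field
      bound     : ℕ
      symmetric : ∀ n → bound ≤ n → P (+ n) ⇔ P -[1+ n ]

  ℤ-induction : (P : ℤ → Set) → EventuallySymmetric P →
                P 0ℤ → (∀ d → P d → P (ℤ.suc d)) → ∀ d → P d
  ℤ-induction P (symmetric-beyond B sym-from-B) P0 P-suc = P-all
    where
    P-+ : ∀ n → P (+ n)
    P-+ zero    = P0
    P-+ (suc n) = P-suc (+ n) (P-+ n)
    P-up : ∀ k n → P -[1+ (k ℕ.+ n) ] → P -[1+ n ]
    P-up zero    n P-k+n = P-k+n
    P-up (suc k) n P-k+n = P-up k n (P-suc _ P-k+n)
    P-all : ∀ d → P d
    P-all (+ n)    = P-+ n
    P-all -[1+ n ] = P-up B n (to (sym-from-B (B ℕ.+ n) (ℕP.m≤m+n B n)) (P-+ (B ℕ.+ n)))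

  evSym-resp : ∀ {P Q : ℤ → Set} → (∀ d → P d ⇔ Q d) → EventuallySymmetric Q → EventuallySymmetric P
  evSym-resp P⇔Q (symmetric-beyond B symQ) = symmetric-beyond B λ n B≤n →
    ⇔.trans (P⇔Q (+ n)) (⇔.trans (symQ n B≤n) (⇔.sym (P⇔Q -[1+ n ])))

  evSym-const : ∀ {A : Set} → EventuallySymmetric (λ _ → A)
  evSym-const = symmetric-beyond 0 λ _ _ → ⇔.refl

  evSym-eventuallyFalse : ∀ {P : ℤ → Set} B → (∀ d → B ≤ ∣ d ∣ → ¬ P d) → EventuallySymmetric P
  evSym-eventuallyFalse B ¬P = symmetric-beyond B λ n B≤n →
    mk⇔ (⊥-elim ∘ ¬P (+ n) B≤n) (⊥-elim ∘ ¬P -[1+ n ] (ℕP.m≤n⇒m≤1+n B≤n))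

  evSym-combine : ∀ {P Q : ℤ → Set} (_∙_ : Set → Set → Set) →
                  (∀ {A A′ B B′} → A ⇔ A′ → B ⇔ B′ → (A ∙ B) ⇔ (A′ ∙ B′)) →
                  EventuallySymmetric P → EventuallySymmetric Q → EventuallySymmetric (λ d → P d ∙ Q d)
  evSym-combine _∙_ ∙-cong (symmetric-beyond B₁ symP) (symmetric-beyond B₂ symQ) =
    symmetric-beyond (B₁ ℕ.+ B₂) λ n B≤n →
    ∙-cong (symP n (ℕP.≤-trans (ℕP.m≤m+n B₁ B₂) B≤n)) (symQ n (ℕP.≤-trans (ℕP.m≤n+m B₂ B₁) B≤n))

  Affine : (ℤ → ℤ) → Set
  Affine f = Σ ℕ λ c → Σ ℤ λ p → ∀ d → f d ≡ + c * d + p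

  affine-const : ∀ p → Affine (λ _ → p)
  affine-const p = 0 , p , λ d → absorb d p
    where
    absorb : ∀ d p → p ≡ 0ℤ * d + p
    absorb = solve-∀

  affine-id : Affine id
  affine-id = 1 , 0ℤ , unit
    where
    unit : ∀ d → d ≡ 1ℤ * d + 0ℤ
    unit = solve-∀

  affine-suc : ∀ {f} → Affine f → Affine (ℤ.suc ∘ f)
  affine-suc (c , p , f≡) = c , 1ℤ + p , λ d → trans (cong ℤ.suc (f≡ d)) (shift (+ c) d p)
    where
    shift : ∀ c d p → 1ℤ + (c * d + p) ≡ c * d + (1ℤ + p)
    shift = solve-∀

  affine-+ : ∀ {f g} → Affine f → Affine g → Affine (λ d → f d + g d)
  affine-+ (c₁ , p₁ , f≡) (c₂ , p₂ , g≡) = c₁ ℕ.+ c₂ , p₁ + p₂ , λ d → begin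
    _                               ≡⟨ cong₂ _+_ (f≡ d) (g≡ d) ⟩
    (+ c₁ * d + p₁) + (+ c₂ * d + p₂) ≡⟨ collect (+ c₁) (+ c₂) d p₁ p₂ ⟩
    (+ c₁ + + c₂) * d + (p₁ + p₂)   ≡⟨ cong (λ c → c * d + (p₁ + p₂)) (ℤP.pos-+ c₁ c₂) ⟨
    + (c₁ ℕ.+ c₂) * d + (p₁ + p₂)   ∎
    where
    open ≡-Reasoning
    collect : ∀ c₁ c₂ d p₁ p₂ → (c₁ * d + p₁) + (c₂ * d + p₂) ≡ (c₁ + c₂) * d + (p₁ + p₂)
    collect = solve-∀

  ∣i∣≤∣i+j∣+∣j∣ : ∀ i j → ∣ i ∣ ≤ ∣ i + j ∣ ℕ.+ ∣ j ∣
  ∣i∣≤∣i+j∣+∣j∣ i j =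
    ℕP.≤-trans (ℕP.≤-reflexive (cong ∣_∣ (sym (i+j-j i j)))) (ℤP.∣i-j∣≤∣i∣+∣j∣ (i + j) j)
    where
    i+j-j : ∀ i j → i + j - j ≡ i
    i+j-j = solve-∀

  slope-bound : ∀ {a b d p q} → a ≢ b → a * d + p ≡ b * d + q → ∣ d ∣ ≤ ∣ q - p ∣
  slope-bound {a} {b} {d} {p} {q} a≢b eq = begin
    ∣ d ∣                ≤⟨ ℕP.m≤n*m ∣ d ∣ ∣ a - b ∣ {{ℤ.≢-nonZero (a≢b ∘ ℤP.i-j≡0⇒i≡j a b)}} ⟩
    ∣ a - b ∣ ℕ.* ∣ d ∣  ≡⟨ ℤP.abs-* (a - b) d ⟨
    ∣ (a - b) * d ∣      ≡⟨ cong ∣_∣ difference ⟩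
    ∣ q - p ∣            ∎
    where
    open ℕP.≤-Reasoning
    expand : ∀ a b d p q → (a - b) * d ≡ (a * d + p) - (b * d + q) + (q - p)
    expand = solve-∀
    cancel : ∀ x y → x - x + y ≡ y
    cancel = solve-∀
    difference : (a - b) * d ≡ q - p
    difference = trans (expand a b d p q)
      (trans (cong (λ x → x - (b * d + q) + (q - p)) eq) (cancel (b * d + q) (q - p)))

  affine-≡-evSym : ∀ {f g} → Affine f → Affine g → EventuallySymmetric (λ d → f d ≡ g d)
  affine-≡-evSym (c₁ , p , f≡) (c₂ , q , g≡) with c₁ ℕP.≟ c₂
  ... | yes refl = evSym-resp (λ d → ⇔.trans (≡⇒⇔ (cong₂ _≡_ (f≡ d) (g≡ d)))
                                              (mk⇔ (∙-cancelˡ (+ c₁ * d) p q) (cong (_+_ (+ c₁ * d)))))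
                              evSym-const
  ... | no c₁≢c₂ = evSym-eventuallyFalse (suc ∣ q - p ∣) λ d large fd≡gd →
    ℕP.<⇒≱ large (slope-bound (c₁≢c₂ ∘ ℤP.+-injective) (trans (sym (f≡ d)) (trans fd≡gd (g≡ d))))

  infix 4 _▷ᶻ_ _▷ᶻ?_
  _▷ᶻ_ : ℤ → ℤ → Set
  + n      ▷ᶻ y = y ≡ + triangular n
  -[1+ n ] ▷ᶻ y = ⊥

  _▷ᶻ?_ : Decidable _▷ᶻ_
  + n      ▷ᶻ? y = y ℤP.≟ + triangular n
  -[1+ n ] ▷ᶻ? y = no λ ()

  ▷ᶻ-inversion : ∀ {x y} → x ▷ᶻ y → ∃[ m ] (x ≡ + m × y ≡ + triangular m)
  ▷ᶻ-inversion {+ m} y≡ = m , refl , y≡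

  positive-slope-▷ᶻ : ∀ k p c q d → affine-threshold c ∣ p ∣ ∣ q ∣ ≤ ∣ d ∣ →
                      ¬ (+ suc k * d + p ▷ᶻ + c * d + q)
  positive-slope-▷ᶻ k p c q (+ n) large fd▷gd with ▷ᶻ-inversion fd▷gd
  ... | m , fd≡m , gd≡Tm = triangular≰affine {C = c} {Q = ∣ q ∣} large n≤m+∣p∣ Tm≤cn+∣q∣
    where
    open ℕP.≤-Reasoning
    n≤m+∣p∣ : n ≤ m ℕ.+ ∣ p ∣
    n≤m+∣p∣ = begin
      n                              ≤⟨ ℕP.m≤n*m n (suc k) ⟩
      suc k ℕ.* n                    ≡⟨ ℤP.abs-* (+ suc k) (+ n) ⟨
      ∣ + suc k * + n ∣              ≤⟨ ∣i∣≤∣i+j∣+∣j∣ (+ suc k * + n) p ⟩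
      ∣ + suc k * + n + p ∣ ℕ.+ ∣ p ∣ ≡⟨ cong (λ x → ∣ x ∣ ℕ.+ ∣ p ∣) fd≡m ⟩
      m ℕ.+ ∣ p ∣                    ∎
    Tm≤cn+∣q∣ : triangular m ≤ c ℕ.* n ℕ.+ ∣ q ∣
    Tm≤cn+∣q∣ = begin
      triangular m                   ≡⟨ cong ∣_∣ gd≡Tm ⟨
      ∣ + c * + n + q ∣              ≤⟨ ℤP.∣i+j∣≤∣i∣+∣j∣ (+ c * + n) q ⟩
      ∣ + c * + n ∣ ℕ.+ ∣ q ∣        ≡⟨ cong (ℕ._+ ∣ q ∣) (ℤP.abs-* (+ c) (+ n)) ⟩
      c ℕ.* n ℕ.+ ∣ q ∣              ∎
  positive-slope-▷ᶻ k p c q -[1+ n ] large fd▷gd with ▷ᶻ-inversion fd▷gd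
  ... | m , fd≡m , _ = ℕP.<⇒≱ (ℕP.<-≤-trans (ℕP.m<m+n ∣ p ∣ (s≤s z≤n)) large) (begin
      suc n                          ≤⟨ ℕP.m≤n*m (suc n) (suc k) ⟩
      suc k ℕ.* suc n                ≤⟨ ℕP.m≤n+m _ m ⟩
      m ℕ.+ suc k ℕ.* suc n          ≡⟨ cong ∣_∣ p≡ ⟩
      ∣ p ∣                          ∎)
    where
    open ℕP.≤-Reasoning
    add-back : ∀ x y p → (x * - y + p) + x * y ≡ p
    add-back = solve-∀
    p≡ : + m + + suc k * + suc n ≡ p
    p≡ = trans (cong (_+ + suc k * + suc n) (sym fd≡m)) (add-back (+ suc k) (+ suc n) p)

  affine-▷ᶻ-evSym : ∀ {f g} → Affine f → Affine g → EventuallySymmetric (λ d → f d ▷ᶻ g d)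
  affine-▷ᶻ-evSym {g = g} (zero , p , f≡) g-affine =
    evSym-resp (λ d → ≡⇒⇔ (cong (_▷ᶻ g d) (trans (f≡ d) (drop d p)))) (constant-▷ᶻ-evSym p)
    where
    drop : ∀ d p → 0ℤ * d + p ≡ p
    drop = solve-∀
    constant-▷ᶻ-evSym : ∀ p → EventuallySymmetric (λ d → p ▷ᶻ g d)
    constant-▷ᶻ-evSym (+ m)    = affine-≡-evSym g-affine (affine-const (+ triangular m))
    constant-▷ᶻ-evSym -[1+ m ] = evSym-const
  affine-▷ᶻ-evSym (suc k , p , f≡) (c , q , g≡) =
    evSym-eventuallyFalse (affine-threshold c ∣ p ∣ ∣ q ∣) λ d large fd▷gd →
      positive-slope-▷ᶻ k p c q d large (to (≡⇒⇔ (cong₂ _▷ᶻ_ (f≡ d) (g≡ d))) fd▷gd)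

  ℤ▷ : Structure
  ℤ▷ = record { D = ℤ ; z = 0ℤ ; s = ℤ.suc ; add = _+_ ; tri = _▷ᶻ_ }

  open DoubleNegation ℤ▷
  open Soundness (λ a b → decidable-stable (a ℤP.≟ b)) (λ a b → decidable-stable (a ▷ᶻ? b))

  evalT-affine : ∀ ρ t → Affine (λ d → ⟦ t ⟧ₜ (d ∷ ρ))
  evalT-affine ρ (v zero)    = affine-id
  evalT-affine ρ (v (suc i)) = affine-const (ρ i)
  evalT-affine ρ 𝟘           = affine-const 0ℤ
  evalT-affine ρ (𝕤 t)       = affine-suc (evalT-affine ρ t)
  evalT-affine ρ (t ⊕ u)     = affine-+ (evalT-affine ρ t) (evalT-affine ρ u)

  QF-evSym : ∀ ψ → QF ψ → ∀ ρ → EventuallySymmetric (λ d → Satᶜ (d ∷ ρ) ψ)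
  QF-evSym ⊥ᶠ       _          ρ = evSym-const
  QF-evSym (t ≐ u)  _          ρ = affine-≡-evSym (evalT-affine ρ t) (evalT-affine ρ u)
  QF-evSym (t ▷ u)  _          ρ = affine-▷ᶻ-evSym (evalT-affine ρ t) (evalT-affine ρ u)
  QF-evSym (φ ⇒ ψ)  (qφ , qψ) ρ =
    evSym-combine (λ A B → A → B) →-cong-⇔ (QF-evSym φ qφ ρ) (QF-evSym ψ qψ ρ)
  QF-evSym (φ ∧ᶠ ψ) (qφ , qψ) ρ =
    evSym-combine _×_ _×-⇔_ (QF-evSym φ qφ ρ) (QF-evSym ψ qψ ρ)
  QF-evSym (φ ∨ᶠ ψ) (qφ , qψ) ρ =
    evSym-combine (λ A B → ¬ ¬ (A ⊎ B)) (λ A⇔ B⇔ → ¬-cong-⇔ (¬-cong-⇔ (A⇔ ⊎-⇔ B⇔)))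
                  (QF-evSym φ qφ ρ) (QF-evSym ψ qψ ρ)

  IOpen-valid : ∀ {φ} → IOpen φ → ∀ ρ → Satᶜ ρ φ
  IOpen-valid (m , ψ , qψ , _ , refl) = Satᶜ-∀ⁿ m _ λ ρ ψ0 ψ-step →
    ℤ-induction (λ d → Satᶜ (d ∷ ρ) ψ) (QF-evSym ψ qψ ρ)
      (to (Satᶜ-[] ψ 𝟘) ψ0)
      (λ d ψd → to (Satᶜ-⟨⟩ ψ (𝕤 (v 0))) (ψ-step d ψd))

  S▷-holds-at-−1 : ∀ ρ → Satᶜ (-1ℤ ∷ ρ) ⟦ S▷ ⟧
  S▷-holds-at-−1 ρ =
    (λ x → holds (ℤP.+-identityʳ x)) ,
    (λ x y → holds (suc-comm x y)) ,
    holds refl ,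
    (λ x y ¬clause → ¬clause (inj₁ λ x▷y → ¬clause (inj₂ (holds (▷ᶻ-step x y x▷y))))) ,
    (λ y → holds λ ()) ,
    id
    where
    holds : ∀ {A B : Set} → A → ¬ ¬ (A ⊎ B)
    holds a ¬a⊎b = ¬a⊎b (inj₁ a)
    suc-comm : ∀ x y → x + (1ℤ + y) ≡ 1ℤ + (x + y)
    suc-comm = solve-∀
    ▷ᶻ-step : ∀ x y → x ▷ᶻ y → ℤ.suc x ▷ᶻ ℤ.suc x + y
    ▷ᶻ-step (+ n) _ refl = refl

  S▷-not-refuted-by-IOpen : ¬ (IOpen ⊢ ∀ᶠ (¬ᶠ ⟦ S▷ ⟧))
  S▷-not-refuted-by-IOpen ⊢¬S =
    sound ⊢¬S ρ₀ (satisfies λ ax → IOpen-valid ax ρ₀) -1ℤ (S▷-holds-at-−1 ρ₀)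
    where
    ρ₀ : ℕ → ℤ
    ρ₀ _ = 0ℤ

open IntegerModel using (S▷-not-refuted-by-IOpen)

corollary4p5 : RefutableByCycle S▷ × ¬ (IOpen ⊢ ∀ᶠ (¬ᶠ ⟦ S▷ ⟧))
corollary4p5 = S▷-refutable , S▷-not-refuted-by-IOpen
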